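{- Let $q=c/d$ be a positive rational number ($c,d$ positive integers). Let $W_q(x)=\sum_{n\geq0}|\mathcal{W}_n^q|x^n$ and write $\Gamma(x)=\frac{x(1+W_q(x))}{1-x}=\sum_{n\geq0}a_nx^n$. Let $\Gamma_{c/d}(x)=\sum_{n\geq 0}a_nx^{1+\left\lfloor\frac{(c+d)n}{c}\right\rfloor}$. Then the generating function $P_q(x)$ of prime intervals satisfies $$P_q(x)=\frac{\Gamma_{c/d}(x)}{1-x}.$$
   Context: A $q$-decreasing word of length $n$ is a binary word of length $n$ in which every maximal factor $0^a1^b$ satisfies $a=0$ or $qa>b$; $\mathcal{W}_n^q$ is the set of them, ordered componentwise ($v\leq w$ iff $v_i\leq w_i$ for all $i$). An interval $[v,w]$ ($v\leq w$) in $\mathcal{W}_n^q$ is prime if $w=0^a1^b$ with $a+b=n$ and $qa>b\geq1$. $P_q(x)=\sum_n p_nx^n$ where $p_n$ is the number of prime intervals in $\mathcal{W}_n^q$. -}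

module Defs where

open import Data.Bool using (Bool; true; false; _∧_; _∨_; not; if_then_else_)
open import Data.Nat using (ℕ; zero; suc; _+_; _*_; _∸_; _<ᵇ_; _≡ᵇ_; _≤ᵇ_; NonZero)
open import Data.Nat.DivMod using (_/_)
open import Data.List using (List; []; _∷_; map; _++_; length; replicate; filterᵇ; cartesianProduct)
open import Data.Bool.ListAction using (any)
open import Data.Product using (_×_; _,_; proj₁; proj₂)

-- Binary words (false = 0, true = 1), all words of length n.

Word : Set
Word = List Bool

allWords : ℕ → List Word
allWords zero    = [] ∷ []
allWords (suc n) = map (false ∷_) (allWords n) ++ map (true ∷_) (allWords n)

countLead : Bool → Word → ℕ
countLead x []      = zero
countLead true  (true  ∷ w) = suc (countLead true w)
countLead true  (false ∷ w) = zero
countLead false (false ∷ w) = suc (countLead false w)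
countLead false (true  ∷ w) = zero

dropLead : Bool → Word → Word
dropLead x []      = []
dropLead true  (true  ∷ w) = dropLead true w
dropLead true  (false ∷ w) = false ∷ w
dropLead false (false ∷ w) = dropLead false w
dropLead false (true  ∷ w) = true ∷ w

-- q-decreasing for q = c/d:  every maximal factor 0^a 1^b has a = 0 or
-- (c/d)·a > b, i.e. d·b < c·a.  The flag says whether the previous letter
-- was a 0 (so that the condition is checked exactly once, at the start of
-- each maximal run of 0s; a = length of that run, b = length of the run of
-- 1s following it, b = 0 if none).  Maximal factors with a = 0 (a leading
-- run of 1s) impose no condition.
qdecFrom : (c d : ℕ) → Bool → Word → Bool
qdecFrom c d p []            = true
qdecFrom c d p (true  ∷ w)   = qdecFrom c d false w
qdecFrom c d true  (false ∷ w) = qdecFrom c d true w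
qdecFrom c d false (false ∷ w) =
  (d * countLead true (dropLead false w) <ᵇ c * suc (countLead false w))
  ∧ qdecFrom c d true w

isQDec : (c d : ℕ) → Word → Bool
isQDec c d = qdecFrom c d false

leqW : Word → Word → Bool
leqW []      []      = true
leqW (x ∷ v) (y ∷ w) = (not x ∨ y) ∧ leqW v w
leqW _       _       = false

eqW : Word → Word → Bool
eqW v w = leqW v w ∧ leqW w v

wCount : (c d : ℕ) → ℕ → ℕ
wCount c d n = length (filterᵇ (isQDec c d) (allWords n))

isPrimeTop : (c d n : ℕ) → Word → Bool
isPrimeTop c d n w =
  any (λ b → (1 ≤ᵇ b) ∧ (d * b <ᵇ c * (n ∸ b))
             ∧ eqW w (replicate (n ∸ b) false ++ replicate b true))
      (Data.List.upTo (suc n))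

isPrimeInterval : (c d n : ℕ) → Word × Word → Bool
isPrimeInterval c d n (v , w) =
  isQDec c d v ∧ isQDec c d w ∧ leqW v w ∧ isPrimeTop c d n w

primeCount : (c d : ℕ) → ℕ → ℕ
primeCount c d n =
  length (filterᵇ (isPrimeInterval c d n) (cartesianProduct (allWords n) (allWords n)))

Series : Set
Series = ℕ → ℕ

sumBelow : ℕ → (ℕ → ℕ) → ℕ
sumBelow zero    f = 0
sumBelow (suc n) f = sumBelow n f + f n

divOneMinusX : Series → Series
divOneMinusX f n = sumBelow (suc n) f

mulX : Series → Series
mulX f zero    = 0
mulX f (suc n) = f n

onePlus : Series → Series
onePlus f zero    = suc (f zero)
onePlus f (suc n) = f (suc n)

Wq : (c d : ℕ) → Series
Wq c d = wCount c d

Γ : (c d : ℕ) → Series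
Γ c d = divOneMinusX (mulX (onePlus (Wq c d)))

expo : (c d : ℕ) → .{{NonZero c}} → ℕ → ℕ
expo c d k = suc (((c + d) * k) / c)

-- Since expo k ≥ k + 1 > k, only k ≤ m can
-- contribute, so the (finite) sum over k < m + 1 is the full coefficient.
Γcd : (c d : ℕ) → .{{NonZero c}} → Series
Γcd c d m = sumBelow (suc m) (λ k → if expo c d k ≡ᵇ m then Γ c d k else 0)

Pq : (c d : ℕ) → Series
Pq c d = primeCount c d

module Submission where

-- A prime interval [v, w] of W_n^q has top w = 0^a 1^b with a + b = n and d b < c a; in particular
-- a ≥ 1 and w itself is q-decreasing. The words v ≤ w are exactly the words 0^a u with |u| = b, and
-- the first run of 0s of such a v has length at least a and is followed by at most b ones, so it
-- always satisfies the run condition: v is q-decreasing iff u is q-decreasing when read as the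
-- continuation of a run of 0s. Splitting such u by their first letter shows that there are
-- 1 + Σ_{i<b} |W_i^q| = a_b of them (b ≥ 1). Finally d b < c (n - b) says exactly that
-- 1 + ⌊(c+d) b / c⌋ ≤ n, so p_n = Σ {a_b : 1 + ⌊(c+d) b / c⌋ ≤ n}, which is the coefficient of x^n
-- in Γ_{c/d}(x) / (1 - x) after grouping the terms by their exponent.

open import Data.Bool using (Bool; true; false; _∧_; _∨_; if_then_else_; T)
open import Data.Bool.ListAction using (any; or)
open import Data.Bool.Properties using (T-∧; T-≡; ∧-zeroʳ; ∧-assoc)
open import Data.Empty using (⊥-elim)
open import Data.List using (List; []; _∷_; map; _++_; length; replicate; filterᵇ; cartesianProduct; upTo)
open import Data.List.Properties using (map-++; map-cong; map-∘; map-applyUpTo; map-upTo; length-++; length-replicate)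
open import Data.Nat
open import Data.Nat.DivMod using (_/_; m*n/n≡m; /-monoˡ-≤; m<n*o⇒m/o<n)
open import Data.Nat.ListAction using (sum)
open import Data.Nat.ListAction.Properties using (sum-++)
open import Data.Nat.Properties
open import Algebra.Properties.CommutativeSemigroup +-commutativeSemigroup
  using () renaming (interchange to +-interchange)
open import Algebra.Properties.CommutativeSemigroup *-commutativeSemigroup
  using () renaming (x∙yz≈y∙xz to *-left-comm)
open import Data.Product using (_×_; _,_; proj₂)
open import Function using (_∘_)
open import Function.Bundles using (Equivalence; _⇔_; mk⇔)
open import Relation.Binary.PropositionalEquality
open import Relation.Nullary using (¬_)
open import Relation.Nullary.Reflects using (Reflects; ofʸ; ofⁿ; fromEquivalence)

open import Defs

open Equivalence using (to; from)

private variable A B : Set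

𝟙 : Bool → ℕ
𝟙 true  = 1
𝟙 false = 0

𝟙-∧ : ∀ x y → 𝟙 (x ∧ y) ≡ 𝟙 x * 𝟙 y
𝟙-∧ true  y = sym (+-identityʳ (𝟙 y))
𝟙-∧ false y = refl

∑ : List A → (A → ℕ) → ℕ
∑ xs f = sum (map f xs)

infix 5 ∑
syntax ∑ xs (λ x → e) = ∑[ x ∈ xs ] e

length-filterᵇ : ∀ (p : A → Bool) xs → length (filterᵇ p xs) ≡ ∑[ x ∈ xs ] 𝟙 (p x)
length-filterᵇ p []       = refl
length-filterᵇ p (x ∷ xs) with p x
... | true  = cong suc (length-filterᵇ p xs)
... | false = length-filterᵇ p xs

∑-++ : ∀ xs ys (f : A → ℕ) → ∑ (xs ++ ys) f ≡ ∑ xs f + ∑ ys f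
∑-++ xs ys f = trans (cong sum (map-++ f xs ys)) (sum-++ (map f xs) (map f ys))

∑-map : ∀ (g : B → A) xs (f : A → ℕ) → ∑ (map g xs) f ≡ ∑ xs (f ∘ g)
∑-map g xs f = cong sum (sym (map-∘ xs))

∑-cong : ∀ {f g : A → ℕ} → (∀ x → f x ≡ g x) → ∀ xs → ∑ xs f ≡ ∑ xs g
∑-cong f≗g xs = cong sum (map-cong f≗g xs)

∑-zero : ∀ {f : A → ℕ} → (∀ x → f x ≡ 0) → ∀ xs → ∑ xs f ≡ 0
∑-zero f≗0 []       = refl
∑-zero f≗0 (x ∷ xs) = cong₂ _+_ (f≗0 x) (∑-zero f≗0 xs)

∑-*ˡ : ∀ k (f : A → ℕ) xs → ∑[ x ∈ xs ] k * f x ≡ k * ∑ xs f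
∑-*ˡ k f []       = sym (*-zeroʳ k)
∑-*ˡ k f (x ∷ xs) = trans (cong (k * f x +_) (∑-*ˡ k f xs)) (sym (*-distribˡ-+ k (f x) _))

∑-cartesianProduct : ∀ (f : A × B → ℕ) xs ys →
  ∑ (cartesianProduct xs ys) f ≡ ∑[ x ∈ xs ] ∑[ y ∈ ys ] f (x , y)
∑-cartesianProduct f []       ys = refl
∑-cartesianProduct f (x ∷ xs) ys = begin
  ∑ (map (x ,_) ys ++ cartesianProduct xs ys) f
    ≡⟨ ∑-++ (map (x ,_) ys) _ f ⟩
  ∑ (map (x ,_) ys) f + ∑ (cartesianProduct xs ys) f
    ≡⟨ cong₂ _+_ (∑-map (x ,_) ys f) (∑-cartesianProduct f xs ys) ⟩
  (∑[ y ∈ ys ] f (x , y)) + (∑[ x′ ∈ xs ] ∑[ y ∈ ys ] f (x′ , y)) ∎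
  where open ≡-Reasoning

sumBelow-cong : ∀ {m} {f g : ℕ → ℕ} → (∀ i → i < m → f i ≡ g i) → sumBelow m f ≡ sumBelow m g
sumBelow-cong {zero}  f≗g = refl
sumBelow-cong {suc m} f≗g = cong₂ _+_ (sumBelow-cong (λ i i<m → f≗g i (m<n⇒m<1+n i<m))) (f≗g m ≤-refl)

sumBelow-zero : ∀ {f : ℕ → ℕ} → (∀ i → f i ≡ 0) → ∀ m → sumBelow m f ≡ 0
sumBelow-zero f≗0 zero    = refl
sumBelow-zero f≗0 (suc m) = cong₂ _+_ (sumBelow-zero f≗0 m) (f≗0 m)

sumBelow-+ : ∀ m (f g : ℕ → ℕ) → sumBelow m (λ i → f i + g i) ≡ sumBelow m f + sumBelow m g
sumBelow-+ zero    f g = refl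
sumBelow-+ (suc m) f g = trans (cong (_+ (f m + g m)) (sumBelow-+ m f g))
                               (+-interchange (sumBelow m f) (sumBelow m g) (f m) (g m))

sumBelow-suc : ∀ m (f : ℕ → ℕ) → sumBelow (suc m) f ≡ f 0 + sumBelow m (f ∘ suc)
sumBelow-suc zero    f = sym (+-identityʳ (f 0))
sumBelow-suc (suc m) f = trans (cong (_+ f (suc m)) (sumBelow-suc m f)) (+-assoc (f 0) _ _)

∑-sumBelow : ∀ m (f : A → ℕ → ℕ) xs →
  ∑[ x ∈ xs ] sumBelow m (f x) ≡ sumBelow m (λ i → ∑[ x ∈ xs ] f x i)
∑-sumBelow m f []       = sym (sumBelow-zero (λ _ → refl) m)
∑-sumBelow m f (x ∷ xs) = trans (cong (sumBelow m (f x) +_) (∑-sumBelow m f xs))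
                                (sym (sumBelow-+ m (f x) (λ i → ∑[ x′ ∈ xs ] f x′ i)))

sumBelow-*ˡ : ∀ k m (f : ℕ → ℕ) → sumBelow m (λ i → k * f i) ≡ k * sumBelow m f
sumBelow-*ˡ k zero    f = sym (*-zeroʳ k)
sumBelow-*ˡ k (suc m) f = trans (cong (_+ k * f m) (sumBelow-*ˡ k m f)) (sym (*-distribˡ-+ k _ (f m)))

any-upTo-suc : ∀ (p : ℕ → Bool) m → any p (upTo (suc m)) ≡ p 0 ∨ any (p ∘ suc) (upTo m)
any-upTo-suc p m = cong (λ bs → p 0 ∨ or bs) (trans (map-applyUpTo suc p m) (sym (map-upTo (p ∘ suc) m)))

𝟙-any-upTo : ∀ (p : ℕ → Bool) → (∀ {i j} → T (p i) → T (p j) → i ≡ j) →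
             ∀ m → 𝟙 (any p (upTo m)) ≡ sumBelow m (𝟙 ∘ p)
𝟙-any-upTo p unique zero    = refl
𝟙-any-upTo p unique (suc m) = begin
  𝟙 (any p (upTo (suc m)))          ≡⟨ cong 𝟙 (any-upTo-suc p m) ⟩
  𝟙 (p 0 ∨ any (p ∘ suc) (upTo m))  ≡⟨ head-or-tail ⟩
  𝟙 (p 0) + sumBelow m (𝟙 ∘ p ∘ suc) ≡⟨ sym (sumBelow-suc m (𝟙 ∘ p)) ⟩
  sumBelow (suc m) (𝟙 ∘ p)          ∎
  where
  open ≡-Reasoning
  head-or-tail : 𝟙 (p 0 ∨ any (p ∘ suc) (upTo m)) ≡ 𝟙 (p 0) + sumBelow m (𝟙 ∘ p ∘ suc)
  head-or-tail with p 0 in p0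
  ... | false = 𝟙-any-upTo (p ∘ suc) (λ pi pj → suc-injective (unique pi pj)) m
  ... | true  = cong suc (sym (sumBelow-zero tail-false m))
    where
    tail-false : ∀ i → 𝟙 (p (suc i)) ≡ 0
    tail-false i with p (suc i) in psi
    ... | false = refl
    ... | true  with () ← unique (T-≡ .from p0) (T-≡ .from psi)

block : ℕ → ℕ → Word
block a b = replicate a false ++ replicate b true

length-block : ∀ a b → length (block a b) ≡ a + b
length-block a b = trans (length-++ (replicate a false)) (cong₂ _+_ (length-replicate a) (length-replicate b))

weight : Word → ℕ
weight []          = 0
weight (true  ∷ w) = suc (weight w)
weight (false ∷ w) = weight w

weight-block : ∀ a b → weight (block a b) ≡ b
weight-block (suc a) b       = weight-block a b
weight-block zero    zero    = refl
weight-block zero    (suc b) = cong suc (weight-block zero b)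

eqW⇒≡ : ∀ v w → T (eqW v w) → v ≡ w
eqW⇒≡ []          []          _ = refl
eqW⇒≡ (true  ∷ v) (true  ∷ w) e = cong (true ∷_) (eqW⇒≡ v w e)
eqW⇒≡ (false ∷ v) (false ∷ w) e = cong (false ∷_) (eqW⇒≡ v w e)
eqW⇒≡ (false ∷ v) (true  ∷ w) e with () ← proj₂ (T-∧ {leqW v w} .to e)

∑-allWords-suc : ∀ n (f : Word → ℕ) →
  ∑ (allWords (suc n)) f ≡ (∑[ w ∈ allWords n ] f (false ∷ w)) + (∑[ w ∈ allWords n ] f (true ∷ w))
∑-allWords-suc n f = trans (∑-++ (map (false ∷_) (allWords n)) _ f)
                           (cong₂ _+_ (∑-map (false ∷_) (allWords n) f) (∑-map (true ∷_) (allWords n) f))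

∑-allWords-cong : ∀ n {f g : Word → ℕ} → (∀ w → length w ≡ n → f w ≡ g w) →
  ∑ (allWords n) f ≡ ∑ (allWords n) g
∑-allWords-cong zero    f≗g = cong (_+ 0) (f≗g [] refl)
∑-allWords-cong (suc n) {f} {g} f≗g = begin
  ∑ (allWords (suc n)) f
    ≡⟨ ∑-allWords-suc n f ⟩
  (∑[ w ∈ allWords n ] f (false ∷ w)) + (∑[ w ∈ allWords n ] f (true ∷ w))
    ≡⟨ cong₂ _+_ (∑-allWords-cong n (λ w l → f≗g (false ∷ w) (cong suc l)))
                 (∑-allWords-cong n (λ w l → f≗g (true ∷ w) (cong suc l))) ⟩
  (∑[ w ∈ allWords n ] g (false ∷ w)) + (∑[ w ∈ allWords n ] g (true ∷ w))
    ≡⟨ ∑-allWords-suc n g ⟨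
  ∑ (allWords (suc n)) g ∎
  where open ≡-Reasoning

∑-allWords-eqW : ∀ {n} (f : Word → ℕ) t → length t ≡ n →
  ∑[ w ∈ allWords n ] f w * 𝟙 (eqW w t) ≡ f t
∑-allWords-eqW f [] refl = trans (+-identityʳ (f [] * 1)) (*-identityʳ (f []))
∑-allWords-eqW f (false ∷ t) refl = begin
  ∑[ w ∈ allWords (suc (length t)) ] f w * 𝟙 (eqW w (false ∷ t))
    ≡⟨ ∑-allWords-suc (length t) (λ w → f w * 𝟙 (eqW w _)) ⟩
  (∑[ w ∈ allWords (length t) ] f (false ∷ w) * 𝟙 (eqW w t))
    + (∑[ w ∈ allWords (length t) ] f (true ∷ w) * 0)
    ≡⟨ cong₂ _+_ (∑-allWords-eqW (f ∘ (false ∷_)) t refl)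
                 (∑-zero (λ w → *-zeroʳ (f (true ∷ w))) (allWords (length t))) ⟩
  f (false ∷ t) + 0
    ≡⟨ +-identityʳ _ ⟩
  f (false ∷ t) ∎
  where open ≡-Reasoning
∑-allWords-eqW f (true ∷ t) refl = begin
  ∑[ w ∈ allWords (suc (length t)) ] f w * 𝟙 (eqW w (true ∷ t))
    ≡⟨ ∑-allWords-suc (length t) (λ w → f w * 𝟙 (eqW w _)) ⟩
  (∑[ w ∈ allWords (length t) ] f (false ∷ w) * 𝟙 (leqW w t ∧ false))
    + (∑[ w ∈ allWords (length t) ] f (true ∷ w) * 𝟙 (eqW w t))
    ≡⟨ cong₂ _+_ (∑-zero (λ w → trans (cong (λ x → f (false ∷ w) * 𝟙 x) (∧-zeroʳ (leqW w t)))
                                      (*-zeroʳ (f (false ∷ w)))) (allWords (length t)))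
                 (∑-allWords-eqW (f ∘ (true ∷_)) t refl) ⟩
  0 + f (true ∷ t) ∎
  where open ≡-Reasoning

∑-allWords-select : ∀ {n} m (f : Word → ℕ) (g : ℕ → ℕ) (t : ℕ → Word) →
  (∀ b → b < m → length (t b) ≡ n) →
  ∑[ w ∈ allWords n ] f w * sumBelow m (λ b → g b * 𝟙 (eqW w (t b))) ≡ sumBelow m (λ b → g b * f (t b))
∑-allWords-select {n} m f g t length-t = begin
  ∑[ w ∈ allWords n ] f w * sumBelow m (λ b → g b * 𝟙 (eqW w (t b)))
    ≡⟨ ∑-cong (λ w → sym (trans (sumBelow-cong {m} (λ b _ → *-left-comm (g b) (f w) (𝟙 (eqW w (t b)))))
                                (sumBelow-*ˡ (f w) m (λ b → g b * 𝟙 (eqW w (t b))))))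
              (allWords n) ⟩
  ∑[ w ∈ allWords n ] sumBelow m (λ b → g b * (f w * 𝟙 (eqW w (t b))))
    ≡⟨ ∑-sumBelow m _ (allWords n) ⟩
  sumBelow m (λ b → ∑[ w ∈ allWords n ] g b * (f w * 𝟙 (eqW w (t b))))
    ≡⟨ sumBelow-cong (λ b b<m → trans (∑-*ˡ (g b) _ (allWords n))
                                      (cong (g b *_) (∑-allWords-eqW f (t b) (length-t b b<m)))) ⟩
  sumBelow m (λ b → g b * f (t b)) ∎
  where open ≡-Reasoning

∑-allWords-below-ones : ∀ b (f : Word → ℕ) →
  ∑[ v ∈ allWords b ] f v * 𝟙 (leqW v (replicate b true)) ≡ ∑ (allWords b) f
∑-allWords-below-ones zero    f = cong (_+ 0) (*-identityʳ (f []))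
∑-allWords-below-ones (suc b) f = begin
  ∑[ v ∈ allWords (suc b) ] f v * 𝟙 (leqW v (replicate (suc b) true))
    ≡⟨ ∑-allWords-suc b (λ v → f v * 𝟙 (leqW v (replicate (suc b) true))) ⟩
  (∑[ v ∈ allWords b ] f (false ∷ v) * 𝟙 (leqW v (replicate b true)))
    + (∑[ v ∈ allWords b ] f (true ∷ v) * 𝟙 (leqW v (replicate b true)))
    ≡⟨ cong₂ _+_ (∑-allWords-below-ones b (f ∘ (false ∷_)))
                 (∑-allWords-below-ones b (f ∘ (true ∷_))) ⟩
  (∑[ v ∈ allWords b ] f (false ∷ v)) + (∑[ v ∈ allWords b ] f (true ∷ v))
    ≡⟨ ∑-allWords-suc b f ⟨
  ∑ (allWords (suc b)) f ∎
  where open ≡-Reasoning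

∑-allWords-below-block : ∀ a b (f : Word → ℕ) →
  ∑[ v ∈ allWords (a + b) ] f v * 𝟙 (leqW v (block a b)) ≡ ∑[ u ∈ allWords b ] f (replicate a false ++ u)
∑-allWords-below-block zero    b f = ∑-allWords-below-ones b f
∑-allWords-below-block (suc a) b f = begin
  ∑[ v ∈ allWords (suc a + b) ] f v * 𝟙 (leqW v (block (suc a) b))
    ≡⟨ ∑-allWords-suc (a + b) (λ v → f v * 𝟙 (leqW v (block (suc a) b))) ⟩
  (∑[ v ∈ allWords (a + b) ] f (false ∷ v) * 𝟙 (leqW v (block a b)))
    + (∑[ v ∈ allWords (a + b) ] f (true ∷ v) * 0)
    ≡⟨ cong₂ _+_ (∑-allWords-below-block a b (f ∘ (false ∷_)))
                 (∑-zero (λ v → *-zeroʳ (f (true ∷ v))) (allWords (a + b))) ⟩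
  (∑[ u ∈ allWords b ] f (replicate (suc a) false ++ u)) + 0
    ≡⟨ +-identityʳ _ ⟩
  ∑[ u ∈ allWords b ] f (replicate (suc a) false ++ u) ∎
  where open ≡-Reasoning

-- q-decreasing words below 0^a 1^b

countLead≤length : ∀ x w → countLead x w ≤ length w
countLead≤length x     []          = z≤n
countLead≤length true  (true  ∷ w) = s≤s (countLead≤length true w)
countLead≤length true  (false ∷ w) = z≤n
countLead≤length false (false ∷ w) = s≤s (countLead≤length false w)
countLead≤length false (true  ∷ w) = z≤n

length-dropLead≤ : ∀ x w → length (dropLead x w) ≤ length w
length-dropLead≤ x     []          = z≤n
length-dropLead≤ true  (true  ∷ w) = m≤n⇒m≤1+n (length-dropLead≤ true w)
length-dropLead≤ true  (false ∷ w) = ≤-refl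
length-dropLead≤ false (false ∷ w) = m≤n⇒m≤1+n (length-dropLead≤ false w)
length-dropLead≤ false (true  ∷ w) = ≤-refl

countLead-zeros++ : ∀ a u → a ≤ countLead false (replicate a false ++ u)
countLead-zeros++ zero    u = z≤n
countLead-zeros++ (suc a) u = s≤s (countLead-zeros++ a u)

dropLead-zeros++ : ∀ a u → dropLead false (replicate a false ++ u) ≡ dropLead false u
dropLead-zeros++ zero    u = refl
dropLead-zeros++ (suc a) u = dropLead-zeros++ a u

module _ (c d : ℕ) where

  qdecFrom-ones : ∀ p b → qdecFrom c d p (replicate b true) ≡ true
  qdecFrom-ones p zero    = refl
  qdecFrom-ones p (suc b) = qdecFrom-ones false b

  qdecFrom-true-zeros++ : ∀ a u → qdecFrom c d true (replicate a false ++ u) ≡ qdecFrom c d true u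
  qdecFrom-true-zeros++ zero    u = refl
  qdecFrom-true-zeros++ (suc a) u = qdecFrom-true-zeros++ a u

  isQDec-zeros++ : ∀ a b u → length u ≡ b → d * b < c * suc a →
                   isQDec c d (replicate (suc a) false ++ u) ≡ qdecFrom c d true u
  isQDec-zeros++ a b u refl lt = cong₂ _∧_ (T-≡ .to (<⇒<ᵇ first-run)) (qdecFrom-true-zeros++ a u)
    where
    first-run : d * countLead true (dropLead false (replicate a false ++ u))
              < c * suc (countLead false (replicate a false ++ u))
    first-run = begin-strict
      d * countLead true (dropLead false (replicate a false ++ u))
        ≡⟨ cong (λ w → d * countLead true w) (dropLead-zeros++ a u) ⟩
      d * countLead true (dropLead false u)
        ≤⟨ *-monoʳ-≤ d (≤-trans (countLead≤length true _) (length-dropLead≤ false u)) ⟩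
      d * length u
        <⟨ lt ⟩
      c * suc a
        ≤⟨ *-monoʳ-≤ c (s≤s (countLead-zeros++ a u)) ⟩
      c * suc (countLead false (replicate a false ++ u)) ∎
      where open ≤-Reasoning

  isQDec-block : ∀ a b → d * b < c * suc a → isQDec c d (block (suc a) b) ≡ true
  isQDec-block a b lt = trans (isQDec-zeros++ a b (replicate b true) (length-replicate b) lt) (qdecFrom-ones true b)

  qdecAfterZeroCount : ℕ → ℕ
  qdecAfterZeroCount b = ∑[ u ∈ allWords b ] 𝟙 (qdecFrom c d true u)

  qdecAfterZeroCount≡Γ : ∀ b → qdecAfterZeroCount (suc b) ≡ Γ c d (suc b)
  qdecAfterZeroCount≡Γ zero    = refl
  qdecAfterZeroCount≡Γ (suc b) =
    trans (∑-allWords-suc (suc b) (𝟙 ∘ qdecFrom c d true))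
          (cong₂ _+_ (qdecAfterZeroCount≡Γ b) (sym (length-filterᵇ (isQDec c d) (allWords (suc b)))))

  intervalCount : ℕ → Word → ℕ
  intervalCount n w = ∑[ v ∈ allWords n ] 𝟙 (isQDec c d v ∧ isQDec c d w ∧ leqW v w)

  intervalCount-block : ∀ {n} a b → a + b ≡ n → d * b < c * a →
                        intervalCount n (block a b) ≡ qdecAfterZeroCount b
  intervalCount-block zero b _ lt = ⊥-elim (n≮0 (subst (d * b <_) (*-zeroʳ c) lt))
  intervalCount-block (suc a) b refl lt = begin
    ∑[ v ∈ allWords (suc a + b) ] 𝟙 (isQDec c d v ∧ isQDec c d (block (suc a) b) ∧ leqW v (block (suc a) b))
      ≡⟨ ∑-cong (λ v → cong (λ x → 𝟙 (isQDec c d v ∧ x ∧ leqW v (block (suc a) b))) (isQDec-block a b lt))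
                (allWords (suc a + b)) ⟩
    ∑[ v ∈ allWords (suc a + b) ] 𝟙 (isQDec c d v ∧ leqW v (block (suc a) b))
      ≡⟨ ∑-cong (λ v → 𝟙-∧ (isQDec c d v) _) (allWords (suc a + b)) ⟩
    ∑[ v ∈ allWords (suc a + b) ] 𝟙 (isQDec c d v) * 𝟙 (leqW v (block (suc a) b))
      ≡⟨ ∑-allWords-below-block (suc a) b (𝟙 ∘ isQDec c d) ⟩
    ∑[ u ∈ allWords b ] 𝟙 (isQDec c d (replicate (suc a) false ++ u))
      ≡⟨ ∑-allWords-cong b (λ u l → cong 𝟙 (isQDec-zeros++ a b u l lt)) ⟩
    qdecAfterZeroCount b ∎
    where open ≡-Reasoning

-- The exponent 1 + ⌊(c+d) k / c⌋

m/o<n⇒m<n*o : ∀ {m n o} .{{_ : NonZero o}} → m / o < n → m < n * o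
m/o<n⇒m<n*o {m} {n} {o} m/o<n = ≰⇒> λ n*o≤m → <⇒≱ m/o<n (begin
  n         ≡⟨ m*n/n≡m n o ⟨
  n * o / o ≤⟨ /-monoˡ-≤ o n*o≤m ⟩
  m / o     ∎)
  where open ≤-Reasoning

module _ (c d : ℕ) .{{_ : NonZero c}} where

  n<expo : ∀ k → k < expo c d k
  n<expo k = s≤s (begin
    k             ≡⟨ m*n/n≡m k c ⟨
    k * c / c     ≤⟨ /-monoˡ-≤ c (≤-trans (≤-reflexive (*-comm k c)) (*-monoˡ-≤ k (m≤m+n c d))) ⟩
    (c + d) * k / c ∎)
    where open ≤-Reasoning

  -- ⌊(c+d) b / c⌋ < a + b  ⇔  (c+d) b < (a+b) c  ⇔  c b + d b < c b + c a
  expo≤⇔ : ∀ a b → expo c d b ≤ a + b ⇔ d * b < c * a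
  expo≤⇔ a b = mk⇔
    (λ lt → +-cancelˡ-< (c * b) (d * b) (c * a)
              (subst₂ _<_ (*-distribʳ-+ b c d) scaled-sum (m/o<n⇒m<n*o lt)))
    (λ lt → m<n*o⇒m/o<n
              (subst₂ _<_ (sym (*-distribʳ-+ b c d)) (sym scaled-sum) (+-monoʳ-< (c * b) lt)))
    where
    scaled-sum : (a + b) * c ≡ c * b + c * a
    scaled-sum = trans (*-comm (a + b) c) (trans (*-distribˡ-+ c a b) (+-comm (c * a) (c * b)))

-- Grouping a sum by the value of a map

≡ᵇ-reflects-≡ : ∀ m n → Reflects (m ≡ n) (m ≡ᵇ n)
≡ᵇ-reflects-≡ m n = fromEquivalence (≡ᵇ⇒≡ m n) (≡⇒≡ᵇ m n)

if-reflects-no : ∀ {P : Set} {b} (y : ℕ) → Reflects P b → ¬ P → (if b then y else 0) ≡ 0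
if-reflects-no y (ofⁿ _) _  = refl
if-reflects-no y (ofʸ p) ¬p = ⊥-elim (¬p p)

if-≤ᵇ-suc : ∀ x m y →
  (if x ≤ᵇ suc m then y else 0) ≡ (if x ≤ᵇ m then y else 0) + (if x ≡ᵇ suc m then y else 0)
if-≤ᵇ-suc x m y
  with x ≤ᵇ m     | ≤ᵇ-reflects-≤ x m
     | x ≡ᵇ suc m | ≡ᵇ-reflects-≡ x (suc m)
     | x ≤ᵇ suc m | ≤ᵇ-reflects-≤ x (suc m)
... | true  | ofʸ x≤m | false | _         | true  | _         = sym (+-identityʳ y)
... | false | _       | true  | _         | true  | _         = refl
... | false | _       | false | _         | false | _         = refl
... | true  | ofʸ x≤m | true  | ofʸ refl  | _     | _         = ⊥-elim (1+n≰n x≤m)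
... | true  | ofʸ x≤m | false | _         | false | ofⁿ x≰1+m = ⊥-elim (x≰1+m (m≤n⇒m≤1+n x≤m))
... | false | _       | true  | ofʸ refl  | false | ofⁿ x≰1+m = ⊥-elim (x≰1+m ≤-refl)
... | false | ofⁿ x≰m | false | ofⁿ x≢1+m | true  | ofʸ x≤1+m =
  ⊥-elim (x≢1+m (≤-antisym x≤1+m (≰⇒> x≰m)))

module _ (e g : ℕ → ℕ) (k<e : ∀ k → k < e k) where

  fibre-beyond : ∀ k m → m ≤ k → (if e k ≡ᵇ m then g k else 0) ≡ 0
  fibre-beyond k m m≤k =
    if-reflects-no (g k) (≡ᵇ-reflects-≡ (e k) m) λ e≡m → <⇒≱ (k<e k) (subst (_≤ k) (sym e≡m) m≤k)

  bound-beyond : ∀ k n → n ≤ k → (if e k ≤ᵇ n then g k else 0) ≡ 0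
  bound-beyond k n n≤k =
    if-reflects-no (g k) (≤ᵇ-reflects-≤ (e k) n) λ e≤n → <⇒≱ (k<e k) (≤-trans e≤n n≤k)

  sumBelow-fibres : ∀ n → sumBelow (suc n) (λ m → sumBelow (suc m) (λ k → if e k ≡ᵇ m then g k else 0))
                        ≡ sumBelow (suc n) (λ k → if e k ≤ᵇ n then g k else 0)
  sumBelow-fibres zero =
    cong (0 +_) (trans (cong (0 +_) (fibre-beyond 0 0 z≤n)) (sym (bound-beyond 0 0 z≤n)))
  sumBelow-fibres (suc n) = begin
    sumBelow (suc n) (λ m → sumBelow (suc m) (fibre m)) + sumBelow (suc (suc n)) (fibre (suc n))
      ≡⟨ cong₂ _+_ (sumBelow-fibres n)
                   (cong (sumBelow (suc n) (fibre (suc n)) +_) (fibre-beyond (suc n) (suc n) ≤-refl)) ⟩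
    sumBelow (suc n) (bounded n) + (sumBelow (suc n) (fibre (suc n)) + 0)
      ≡⟨ cong (sumBelow (suc n) (bounded n) +_) (+-identityʳ _) ⟩
    sumBelow (suc n) (bounded n) + sumBelow (suc n) (fibre (suc n))
      ≡⟨ sumBelow-+ (suc n) (bounded n) (fibre (suc n)) ⟨
    sumBelow (suc n) (λ k → bounded n k + fibre (suc n) k)
      ≡⟨ sumBelow-cong (λ k _ → sym (if-≤ᵇ-suc (e k) n (g k))) ⟩
    sumBelow (suc n) (bounded (suc n))
      ≡⟨ +-identityʳ _ ⟨
    sumBelow (suc n) (bounded (suc n)) + 0
      ≡⟨ cong (sumBelow (suc n) (bounded (suc n)) +_) (bound-beyond (suc n) (suc n) ≤-refl) ⟨
    sumBelow (suc (suc n)) (bounded (suc n)) ∎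
    where
    open ≡-Reasoning
    fibre bounded : ℕ → ℕ → ℕ
    fibre   m k = if e k ≡ᵇ m then g k else 0
    bounded N k = if e k ≤ᵇ N then g k else 0

-- Prime intervals

module _ (c d : ℕ) .{{_ : NonZero c}} where

  primeTopAt : ℕ → ℕ → Bool
  primeTopAt n b = (1 ≤ᵇ b) ∧ (d * b <ᵇ c * (n ∸ b))

  𝟙-isPrimeTop : ∀ n w → 𝟙 (isPrimeTop c d n w)
                         ≡ sumBelow (suc n) (λ b → 𝟙 (primeTopAt n b) * 𝟙 (eqW w (block (n ∸ b) b)))
  𝟙-isPrimeTop n w = trans (𝟙-any-upTo atTop unique (suc n)) (sumBelow-cong {suc n} λ b _ → 𝟙-atTop b)
    where
    top : ℕ → Word
    top b = block (n ∸ b) b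
    atTop : ℕ → Bool
    atTop b = (1 ≤ᵇ b) ∧ (d * b <ᵇ c * (n ∸ b)) ∧ eqW w (top b)
    𝟙-atTop : ∀ b → 𝟙 (atTop b) ≡ 𝟙 (primeTopAt n b) * 𝟙 (eqW w (top b))
    𝟙-atTop b = trans (cong 𝟙 (sym (∧-assoc (1 ≤ᵇ b) _ _))) (𝟙-∧ (primeTopAt n b) _)
    weight-top : ∀ b → T (atTop b) → weight w ≡ b
    weight-top b t = trans (cong weight (eqW⇒≡ w (top b) w≡top)) (weight-block (n ∸ b) b)
      where w≡top = proj₂ (T-∧ {d * b <ᵇ c * (n ∸ b)} .to (proj₂ (T-∧ {1 ≤ᵇ b} .to t)))
    unique : ∀ {i j} → T (atTop i) → T (atTop j) → i ≡ j
    unique {i} {j} ti tj = trans (sym (weight-top i ti)) (weight-top j tj)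

  primeCount-byTop : ∀ n → primeCount c d n
                           ≡ sumBelow (suc n) (λ b → 𝟙 (primeTopAt n b) * intervalCount c d n (block (n ∸ b) b))
  primeCount-byTop n = begin
    length (filterᵇ (isPrimeInterval c d n) (cartesianProduct W W))
      ≡⟨ length-filterᵇ (isPrimeInterval c d n) (cartesianProduct W W) ⟩
    ∑ (cartesianProduct W W) (𝟙 ∘ isPrimeInterval c d n)
      ≡⟨ ∑-cartesianProduct (𝟙 ∘ isPrimeInterval c d n) W W ⟩
    ∑[ v ∈ W ] ∑[ w ∈ W ] 𝟙 (isPrimeInterval c d n (v , w))
      ≡⟨ ∑-cong (λ v → ∑-cong (𝟙-isPrimeInterval v) W) W ⟩
    ∑[ v ∈ W ] ∑[ w ∈ W ] below v w * sumBelow (suc n) (λ b → 𝟙 (primeTopAt n b) * 𝟙 (eqW w (top b)))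
      ≡⟨ ∑-cong (λ v → ∑-allWords-select (suc n) (below v) (𝟙 ∘ primeTopAt n) top length-top) W ⟩
    ∑[ v ∈ W ] sumBelow (suc n) (λ b → 𝟙 (primeTopAt n b) * below v (top b))
      ≡⟨ ∑-sumBelow (suc n) _ W ⟩
    sumBelow (suc n) (λ b → ∑[ v ∈ W ] 𝟙 (primeTopAt n b) * below v (top b))
      ≡⟨ sumBelow-cong {suc n} (λ b _ → ∑-*ˡ (𝟙 (primeTopAt n b)) (λ v → below v (top b)) W) ⟩
    sumBelow (suc n) (λ b → 𝟙 (primeTopAt n b) * intervalCount c d n (top b)) ∎
    where
    open ≡-Reasoning
    W : List Word
    W = allWords n
    top : ℕ → Word
    top b = block (n ∸ b) b
    length-top : ∀ b → b < suc n → length (top b) ≡ n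
    length-top b b≤n = trans (length-block (n ∸ b) b) (m∸n+n≡m (≤-pred b≤n))
    below : Word → Word → ℕ
    below v w = 𝟙 (isQDec c d v ∧ isQDec c d w ∧ leqW v w)
    𝟙-isPrimeInterval : ∀ v w → 𝟙 (isPrimeInterval c d n (v , w))
                              ≡ below v w * sumBelow (suc n) (λ b → 𝟙 (primeTopAt n b) * 𝟙 (eqW w (top b)))
    𝟙-isPrimeInterval v w = begin
      𝟙 (isQDec c d v ∧ isQDec c d w ∧ leqW v w ∧ isPrimeTop c d n w)
        ≡⟨ cong 𝟙 (trans (cong (isQDec c d v ∧_) (sym (∧-assoc (isQDec c d w) _ _)))
                         (sym (∧-assoc (isQDec c d v) _ _))) ⟩
      𝟙 ((isQDec c d v ∧ isQDec c d w ∧ leqW v w) ∧ isPrimeTop c d n w)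
        ≡⟨ 𝟙-∧ (isQDec c d v ∧ isQDec c d w ∧ leqW v w) _ ⟩
      below v w * 𝟙 (isPrimeTop c d n w)
        ≡⟨ cong (below v w *_) (𝟙-isPrimeTop n w) ⟩
      below v w * sumBelow (suc n) (λ b → 𝟙 (primeTopAt n b) * 𝟙 (eqW w (top b))) ∎

  primeTopContribution : ∀ n b → b ≤ n → 𝟙 (primeTopAt n b) * intervalCount c d n (block (n ∸ b) b)
                             ≡ (if expo c d b ≤ᵇ n then Γ c d b else 0)
  primeTopContribution n zero _ with expo c d 0 ≤ᵇ n   -- Γ c d 0 = 0
  ... | true  = refl
  ... | false = refl
  primeTopContribution n (suc b) b<n
    with d * suc b <ᵇ c * (n ∸ suc b) | <ᵇ-reflects-< (d * suc b) (c * (n ∸ suc b))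
       | expo c d (suc b) ≤ᵇ n        | ≤ᵇ-reflects-≤ (expo c d (suc b)) n
  ... | true  | ofʸ lt  | true  | _ = trans (+-identityʳ _)
          (trans (intervalCount-block c d (n ∸ suc b) (suc b) (m∸n+n≡m b<n) lt) (qdecAfterZeroCount≡Γ c d b))
  ... | true  | ofʸ lt  | false | ofⁿ ¬le = ⊥-elim (¬le (subst (expo c d (suc b) ≤_) (m∸n+n≡m b<n)
                                                             (expo≤⇔ c d (n ∸ suc b) (suc b) .from lt)))
  ... | false | ofⁿ ¬lt | true  | ofʸ le  = ⊥-elim (¬lt (expo≤⇔ c d (n ∸ suc b) (suc b) .to
                                                             (subst (expo c d (suc b) ≤_) (sym (m∸n+n≡m b<n)) le)))
  ... | false | _       | false | _       = refl

mainTheorem9 : (c d : ℕ) → .{{_ : NonZero c}} → .{{_ : NonZero d}} →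
               (n : ℕ) → Pq c d n ≡ divOneMinusX (Γcd c d) n
mainTheorem9 c d n = begin
  primeCount c d n
    ≡⟨ primeCount-byTop c d n ⟩
  sumBelow (suc n) (λ b → 𝟙 (primeTopAt c d n b) * intervalCount c d n (block (n ∸ b) b))
    ≡⟨ sumBelow-cong {suc n} (λ b b≤n → primeTopContribution c d n b (≤-pred b≤n)) ⟩
  sumBelow (suc n) (λ b → if expo c d b ≤ᵇ n then Γ c d b else 0)
    ≡⟨ sumBelow-fibres (expo c d) (Γ c d) (n<expo c d) n ⟨
  divOneMinusX (Γcd c d) n ∎
  where open ≡-Reasoning
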